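{- Given a $k$-dominating set $D$ of a graph $G$, a lower bound $\delta_L$ on the hyperbolicity of $G$ and vertices $x,y,u\in D$ satisfying $2\,\mathrm{ecc}(u) + d(x,y) - d(x,u) - d(y,u) + K_8 \leq 4\delta_L + 1$ where $K_8=4k_{u}+2k_{x}+2k_{y}\le 8k$, then for each quadruple $u',v',x',y'$ with respective associated dominators $u,v,x,y$, we have $\tau(u',v',x',y') \leq \delta_L$.
   Context: $G=(V,E)$ is a finite, connected, unweighted, simple graph, $d(u,v)$ denotes the shortest-path distance and $\mathrm{ecc}(u)=\max_{v\in V}d(u,v)$ the eccentricity. A $k$-dominating set is a set $D\subseteq V$ such that every vertex is at distance at most $k$ from some vertex of $D$; each $v\in V$ has an associated dominator $D(v)\in D$ with $d(v,D(v))\le k$, $D^{ -1}(u)=\{v: D(v)=u\}$, and $k_u=\max_{v\in D^{ -1}(u)} d(u,v)$. Here $\tau(u,v,x,y)=\frac12\big(d(u,v)+d(x,y)-\max\{d(x,u)+d(y,v), d(x,v)+d(y,u)\}\big)$, and the hyperbolicity $\delta(G)$ is the maximum over quadruples of half the difference between the two largest of $d(u,v)+d(x,y)$, $d(u,x)+d(v,y)$, $d(u,y)+d(v,x)$ (equivalently $\max\tau$). -}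

module Defs where

open import Data.Nat using (ℕ; zero; suc; _≤_; _⊔_)
open import Data.Integer as ℤ using (ℤ; +_)
open import Data.Fin using (Fin)
open import Data.Fin.Properties using (_≟_)
open import Data.Fin.Subset using (Subset; _∈_)
open import Data.List using (List; foldr; map; filter)
open import Data.List using () renaming (allFin to allFinL)
open import Data.Bool using (Bool; true)
open import Data.Product using (_×_; Σ; ∃)
open import Relation.Binary.PropositionalEquality using (_≡_)

record Graph (n : ℕ) : Set where
  field
    adj     : Fin n → Fin n → Bool
    symm    : ∀ u v → adj u v ≡ adj v u
    irrefl  : ∀ u → adj u u ≡ Data.Bool.false

open Graph public

data Walk {n : ℕ} (G : Graph n) : Fin n → Fin n → ℕ → Set where
  here : ∀ {u} → Walk G u u 0
  step : ∀ {u w v l} → adj G u w ≡ true → Walk G w v l → Walk G u v (suc l)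

Connected : ∀ {n} → Graph n → Set
Connected G = ∀ u v → ∃ λ l → Walk G u v l

IsDistance : ∀ {n} → Graph n → (Fin n → Fin n → ℕ) → Set
IsDistance G d = ∀ u v → Walk G u v (d u v) × (∀ l → Walk G u v l → d u v ≤ l)

maxL : List ℕ → ℕ
maxL = foldr _⊔_ 0

ecc : ∀ {n} → (Fin n → Fin n → ℕ) → Fin n → ℕ
ecc {n} d u = maxL (map (d u) (allFinL n))

IsKDomination : ∀ {n} → (Fin n → Fin n → ℕ) → ℕ → Subset n → (Fin n → Fin n) → Set
IsKDomination d k D Dm = ∀ v → (Dm v ∈ D) × (d v (Dm v) ≤ k)

-- k_u = max_{v ∈ Dm⁻¹(u)} d(u,v)   (0 if Dm⁻¹(u) is empty)
kOf : ∀ {n} → (Fin n → Fin n → ℕ) → (Fin n → Fin n) → Fin n → ℕ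
kOf {n} d Dm u = maxL (map (d u) (filter (λ v → Dm v ≟ u) (allFinL n)))

-- 2·τ(u,v,x,y) = d(u,v) + d(x,y) − max{d(x,u)+d(y,v), d(x,v)+d(y,u)}  (in ℤ)
twiceTau : ∀ {n} → (Fin n → Fin n → ℕ) → Fin n → Fin n → Fin n → Fin n → ℤ
twiceTau d u v x y =
  (+ (d u v Data.Nat.+ d x y)) ℤ.- (+ ((d x u Data.Nat.+ d y v) ⊔ (d x v Data.Nat.+ d y u)))

{-# OPTIONS --safe #-}
-- Each of the six distances in the four-point sum for u', v', x', y' is
-- compared with one between their dominators (or with ecc(u)) at the cost of
-- the radii k_u, k_x, k_y: d(u',v') ≤ k_u + ecc(u) (used twice), d(x',y') is
-- bounded once through x, y and once through v', and d(x,u), d(y,u) are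
-- bounded through x', u' and y', u'.  Summing gives
--   2·(2τ(u',v',x',y')) ≤ 2·ecc(u) + d(x,y) − d(x,u) − d(y,u) + K₈ ≤ 4δ_L + 1,
-- and since 2τ is an integer, 2τ ≤ 2δ_L.
module Submission where

open import Defs
open import Data.Nat as ℕ using (ℕ; _+_; _*_; suc; _⊔_)
import Data.Nat.Properties as ℕ
open import Data.Nat.Tactic.RingSolver as ℕ-Solver using ()
open import Data.Integer as ℤ using (ℤ; +_)
import Data.Integer.Properties as ℤ
open import Data.Integer.Tactic.RingSolver as ℤ-Solver using ()
open import Data.Fin using (Fin)
open import Data.Fin.Properties using (_≟_)
open import Data.Fin.Subset using (Subset; _∈_)
open import Data.Product using (Σ; proj₁; proj₂)
open import Data.Bool using (true)
open import Data.List using (List; []; _∷_; map)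
open import Data.List.Relation.Unary.Any using (here; there)
import Data.List.Membership.Propositional as List
open import Data.List.Membership.Propositional.Properties using (∈-allFin; ∈-filter⁺)
open import Relation.Binary.PropositionalEquality using (_≡_; refl; trans; sym; cong; subst; subst₂)

module _ {n : ℕ} (G : Graph n) where

  _∷ʳ_ : ∀ {u w v l} → Walk G u w l → adj G w v ≡ true → Walk G u v (suc l)
  here      ∷ʳ e = step e here
  step e′ p ∷ʳ e = step e′ (p ∷ʳ e)

  reverse : ∀ {u v l} → Walk G u v l → Walk G v u l
  reverse here                   = here
  reverse {u} (step {w = w} e p) = reverse p ∷ʳ trans (symm G w u) e

  _++_ : ∀ {u w v l m} → Walk G u w l → Walk G w v m → Walk G u v (l + m)
  here     ++ q = q
  step e p ++ q = step e (p ++ q)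

module Distance {n : ℕ} {G : Graph n} {d : Fin n → Fin n → ℕ} (isd : IsDistance G d) where

  shortest : ∀ {u v l} → Walk G u v l → d u v ℕ.≤ l
  shortest {u} {v} = proj₂ (isd u v) _

  d-sym : ∀ u v → d u v ≡ d v u
  d-sym u v = ℕ.≤-antisym (shortest (reverse G (proj₁ (isd v u))))
                          (shortest (reverse G (proj₁ (isd u v))))

  d-triangle : ∀ u w v → d u v ℕ.≤ d u w + d w v
  d-triangle u w v = shortest (_++_ G (proj₁ (isd u w)) (proj₁ (isd w v)))

  d-detour : ∀ a a′ b′ b → d a b ℕ.≤ d a a′ + d a′ b′ + d b′ b
  d-detour a a′ b′ b = ℕ.≤-trans (d-triangle a b′ b)
    (ℕ.+-monoˡ-≤ (d b′ b) (d-triangle a a′ b′))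

≤-maxL-map : ∀ {A : Set} (f : A → ℕ) {x : A} {xs : List A} →
             x List.∈ xs → f x ℕ.≤ maxL (map f xs)
≤-maxL-map f {xs = y ∷ ys} (here refl) = ℕ.m≤m⊔n (f y) (maxL (map f ys))
≤-maxL-map f {xs = y ∷ ys} (there x∈ys) =
  ℕ.≤-trans (≤-maxL-map f x∈ys) (ℕ.m≤n⊔m (f y) (maxL (map f ys)))

d≤ecc : ∀ {n} (d : Fin n → Fin n → ℕ) u v → d u v ℕ.≤ ecc d u
d≤ecc d u v = ≤-maxL-map (d u) (∈-allFin v)

d≤kOf : ∀ {n} (d : Fin n → Fin n → ℕ) (Dm : Fin n → Fin n) {w v} →
        Dm v ≡ w → d w v ℕ.≤ kOf d Dm w
d≤kOf d Dm {w} {v} Dm[v]≡w =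
  ≤-maxL-map (d w) (∈-filter⁺ (λ v → Dm v ≟ w) (∈-allFin v) Dm[v]≡w)

m+n≤2*[m⊔n] : ∀ m n → m + n ℕ.≤ 2 * (m ⊔ n)
m+n≤2*[m⊔n] m n = ℕ.≤-trans (ℕ.+-mono-≤ (ℕ.m≤m⊔n m n) (ℕ.m≤n⊔m m n))
                            (ℕ.≤-reflexive (cong (λ t → m ⊔ n + t) (sym (ℕ.+-identityʳ (m ⊔ n)))))

i+j≤k+l⇒i-l≤k-j : ∀ {i j k l : ℤ} → i ℤ.+ j ℤ.≤ k ℤ.+ l → i ℤ.- l ℤ.≤ k ℤ.- j
i+j≤k+l⇒i-l≤k-j {i} {j} {k} {l} i+j≤k+l = begin
  i ℤ.- l                 ≡⟨ ℤ-Solver.solve (i ∷ j ∷ l ∷ []) ⟩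
  i ℤ.+ j ℤ.- j ℤ.- l     ≤⟨ ℤ.+-monoˡ-≤ (ℤ.- l) (ℤ.+-monoˡ-≤ (ℤ.- j) i+j≤k+l) ⟩
  k ℤ.+ l ℤ.- j ℤ.- l     ≡⟨ ℤ-Solver.solve (k ∷ j ∷ l ∷ []) ⟩
  k ℤ.- j                 ∎
  where open ℤ.≤-Reasoning

2i≤2j+1⇒i≤j : ∀ {i j : ℤ} → (+ 2) ℤ.* i ℤ.≤ (+ 2) ℤ.* j ℤ.+ (+ 1) → i ℤ.≤ j
2i≤2j+1⇒i≤j {i} {j} 2i≤2j+1 =
  subst (i ℤ.≤_) (ℤ.pred-suc j) (ℤ.i<j⇒i≤pred[j] (ℤ.*-cancelˡ-<-nonNeg (+ 2) 2i<2[1+j]))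
  where
  open ℤ.≤-Reasoning
  2i<2[1+j] : (+ 2) ℤ.* i ℤ.< (+ 2) ℤ.* ((+ 1) ℤ.+ j)
  2i<2[1+j] = begin-strict
    (+ 2) ℤ.* i                ≤⟨ 2i≤2j+1 ⟩
    (+ 2) ℤ.* j ℤ.+ (+ 1)      <⟨ ℤ.+-monoʳ-< ((+ 2) ℤ.* j) (ℤ.+<+ (ℕ.n<1+n 1)) ⟩
    (+ 2) ℤ.* j ℤ.+ (+ 2)      ≡⟨ ℤ-Solver.solve (j ∷ []) ⟩
    (+ 2) ℤ.* ((+ 1) ℤ.+ j)    ∎

module FourPoint {n : ℕ} {G : Graph n} {d : Fin n → Fin n → ℕ} (isd : IsDistance G d)
                 (Dm : Fin n → Fin n) where
  open Distance isd

  K₈ : Fin n → Fin n → Fin n → ℕ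
  K₈ u x y = 4 * kOf d Dm u + 2 * kOf d Dm x + 2 * kOf d Dm y

  module _ {u x y u′ x′ y′ : Fin n} (Dm[u′]≡u : Dm u′ ≡ u) (Dm[x′]≡x : Dm x′ ≡ x)
           (Dm[y′]≡y : Dm y′ ≡ y) (v′ : Fin n) where

    private
      ku = kOf d Dm u
      kx = kOf d Dm x
      ky = kOf d Dm y

      d≤kOf′ : ∀ {w w′} → Dm w′ ≡ w → d w′ w ℕ.≤ kOf d Dm w
      d≤kOf′ {w} {w′} eq = subst (ℕ._≤ kOf d Dm w) (d-sym w w′) (d≤kOf d Dm eq)

    d[u′,v′]≤ : d u′ v′ ℕ.≤ ku + ecc d u
    d[u′,v′]≤ = ℕ.≤-trans (d-triangle u′ u v′) (ℕ.+-mono-≤ (d≤kOf′ Dm[u′]≡u) (d≤ecc d u v′))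

    d[x′,y′]≤through-x,y : d x′ y′ ℕ.≤ kx + d x y + ky
    d[x′,y′]≤through-x,y = ℕ.≤-trans (d-detour x′ x y y′)
      (ℕ.+-mono-≤ (ℕ.+-monoˡ-≤ (d x y) (d≤kOf′ Dm[x′]≡x)) (d≤kOf d Dm Dm[y′]≡y))

    d[x′,y′]≤through-v′ : d x′ y′ ℕ.≤ d x′ v′ + d y′ v′
    d[x′,y′]≤through-v′ = subst (λ t → d x′ y′ ℕ.≤ d x′ v′ + t) (d-sym v′ y′) (d-triangle x′ v′ y′)

    d[w,u]≤ : ∀ {w w′} → Dm w′ ≡ w → d w u ℕ.≤ kOf d Dm w + d w′ u′ + ku
    d[w,u]≤ {w} {w′} eq = ℕ.≤-trans (d-detour w w′ u′ u)
      (ℕ.+-mono-≤ (ℕ.+-monoˡ-≤ (d w′ u′) (d≤kOf d Dm eq)) (d≤kOf′ Dm[u′]≡u))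

    fourPoint-bound :
      2 * (d u′ v′ + d x′ y′) + (d x u + d y u) ℕ.≤
      (2 * ecc d u + d x y + K₈ u x y) + 2 * ((d x′ u′ + d y′ v′) ⊔ (d x′ v′ + d y′ u′))
    fourPoint-bound = begin
      2 * (d u′ v′ + d x′ y′) + (d x u + d y u)
        ≡⟨ expand (d u′ v′) (d x′ y′) (d x u) (d y u) ⟩
      d u′ v′ + d u′ v′ + d x′ y′ + d x′ y′ + d x u + d y u
        ≤⟨ ℕ.+-mono-≤ (ℕ.+-mono-≤ (ℕ.+-mono-≤ (ℕ.+-mono-≤ (ℕ.+-mono-≤
             d[u′,v′]≤ d[u′,v′]≤) d[x′,y′]≤through-x,y) d[x′,y′]≤through-v′)
             (d[w,u]≤ Dm[x′]≡x)) (d[w,u]≤ Dm[y′]≡y) ⟩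
      (ku + ecc d u) + (ku + ecc d u) + (kx + d x y + ky) + (d x′ v′ + d y′ v′)
        + (kx + d x′ u′ + ku) + (ky + d y′ u′ + ku)
        ≡⟨ regroup ku kx ky (ecc d u) (d x y) (d x′ u′) (d y′ v′) (d x′ v′) (d y′ u′) ⟩
      (2 * ecc d u + d x y + K₈ u x y) + ((d x′ u′ + d y′ v′) + (d x′ v′ + d y′ u′))
        ≤⟨ ℕ.+-monoʳ-≤ (2 * ecc d u + d x y + K₈ u x y)
             (m+n≤2*[m⊔n] (d x′ u′ + d y′ v′) (d x′ v′ + d y′ u′)) ⟩
      (2 * ecc d u + d x y + K₈ u x y) + 2 * ((d x′ u′ + d y′ v′) ⊔ (d x′ v′ + d y′ u′)) ∎
      where
      open ℕ.≤-Reasoning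
      expand : ∀ a b c e → 2 * (a + b) + (c + e) ≡ a + a + b + b + c + e
      expand = ℕ-Solver.solve-∀
      regroup : ∀ ku kx ky e xy xu yv xv yu →
        (ku + e) + (ku + e) + (kx + xy + ky) + (xv + yv) + (kx + xu + ku) + (ky + yu + ku)
          ≡ (2 * e + xy + (4 * ku + 2 * kx + 2 * ky)) + ((xu + yv) + (xv + yu))
      regroup = ℕ-Solver.solve-∀

    twice-twiceTau≤ :
      (+ 2) ℤ.* twiceTau d u′ v′ x′ y′
        ℤ.≤ + (2 * ecc d u + d x y + K₈ u x y) ℤ.- + (d x u + d y u)
    twice-twiceTau≤ = begin
      (+ 2) ℤ.* (+ A ℤ.- + M)
        ≡⟨ ℤ.*-distribˡ-+ (+ 2) (+ A) (ℤ.- + M) ⟩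
      (+ 2) ℤ.* (+ A) ℤ.+ (+ 2) ℤ.* ℤ.- + M
        ≡⟨ cong (ℤ._+_ ((+ 2) ℤ.* (+ A))) (ℤ.neg-distribʳ-* (+ 2) (+ M)) ⟨
      (+ 2) ℤ.* (+ A) ℤ.- (+ 2) ℤ.* (+ M)
        ≤⟨ i+j≤k+l⇒i-l≤k-j {(+ 2) ℤ.* (+ A)} {+ S} {+ L} {(+ 2) ℤ.* (+ M)}
             (subst₂ ℤ._≤_ (pos-2*m+n A S) (pos-m+2*n L M) (ℤ.+≤+ fourPoint-bound)) ⟩
      + L ℤ.- + S ∎
      where
      open ℤ.≤-Reasoning
      A = d u′ v′ + d x′ y′
      M = (d x′ u′ + d y′ v′) ⊔ (d x′ v′ + d y′ u′)
      L = 2 * ecc d u + d x y + K₈ u x y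
      S = d x u + d y u
      pos-2*m+n : ∀ m n → + (2 * m + n) ≡ (+ 2) ℤ.* (+ m) ℤ.+ + n
      pos-2*m+n m n = trans (ℤ.pos-+ (2 * m) n) (cong (ℤ._+ + n) (ℤ.pos-* 2 m))
      pos-m+2*n : ∀ m n → + (m + 2 * n) ≡ + m ℤ.+ (+ 2) ℤ.* (+ n)
      pos-m+2*n m n = trans (ℤ.pos-+ m (2 * n)) (cong (ℤ._+_ (+ m)) (ℤ.pos-* 2 n))

lemma4 : ∀ {n} (G : Graph n) → Connected G →
    (d : Fin n → Fin n → ℕ) → IsDistance G d →
    (k : ℕ) (D : Subset n) (Dm : Fin n → Fin n) → IsKDomination d k D Dm →
    (dL2 : ℤ) →
    Σ (Fin n) (λ a → Σ (Fin n) (λ b → Σ (Fin n) (λ c → Σ (Fin n) (λ e →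
      dL2 ℤ.≤ twiceTau d a b c e)))) →
    (x y u : Fin n) → x ∈ D → y ∈ D → u ∈ D →
    (+ (2 * ecc d u + d x y + (4 * kOf d Dm u + 2 * kOf d Dm x + 2 * kOf d Dm y)))
      ℤ.- (+ (d x u + d y u))
      ℤ.≤ (+ 2) ℤ.* dL2 ℤ.+ (+ 1) →
    (u' v' x' y' : Fin n) → Dm u' ≡ u → Dm x' ≡ x → Dm y' ≡ y →
    twiceTau d u' v' x' y' ℤ.≤ dL2
lemma4 G _ d isd _ _ Dm _ _ _ _ _ _ _ _ _ condition _ v' _ _ Dm[u']≡u Dm[x']≡x Dm[y']≡y =
  2i≤2j+1⇒i≤j (ℤ.≤-trans
    (FourPoint.twice-twiceTau≤ isd Dm Dm[u']≡u Dm[x']≡x Dm[y']≡y v') condition)
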